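{- Suppose $|A_1|=3$ and let $s\in\mathbb{Z}_7^*$ be given. There is a labeling $d_1,d_2,d_3$ of the elements of $A_1$ such that, writing $e_{ij}=d_i-d_j$, one of the following holds: (i) $\nu(e_{13})>\nu(e_{23})=\nu(e_{12})$; or (ii) $\nu(e_{13})=\nu(e_{23})=h$ for some $h$, and either (ii.1) $r(e_{13})=2r(e_{23})$, or (ii.2) $r(e_{13})=3r(e_{23})=\pm s$.
   Context: For a nonzero integer $x$, $\nu(x)$ is the largest $k$ with $7^k\mid x$, and $r(x)$ is the residue modulo $7$ of $x/7^{\nu(x)}$ (relations between $r$-values are modulo 7). $A$ is a set of five integers, none divisible by $7$, with residues modulo $7$ in $\{1,2,4\}$; $A_1$ is a largest subset of $A$ consisting of elements with the same residue modulo $7$. -}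

module Defs where

open import Data.Nat using (ℕ; zero; suc; _*_; _%_; _/_; _≤_)
open import Data.Nat.Properties using (_≟_)
open import Data.Integer as ℤ using (ℤ; ∣_∣; sign; _◃_; _-_)
open import Data.Integer.DivMod using (_%ℕ_)
open import Data.Nat using (_>_; _∸_)
open import Data.Product using (_×_; _,_; proj₁; proj₂; Σ; ∃)
open import Data.Fin using (Fin)
open import Function.Definitions using (Injective)
open import Relation.Binary.PropositionalEquality using (_≡_)
open import Relation.Nullary using (¬_; yes; no)

-- strip fuel n = (k , m) with n = 7^k * m and 7 ∤ m  (for n ≠ 0, fuel ≥ n)
strip : ℕ → ℕ → ℕ × ℕ
strip zero    n       = (0 , n)
strip (suc f) zero    = (0 , 0)
strip (suc f) (suc n) with (suc n) % 7 ≟ 0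
... | yes _ = let p = strip f (suc n / 7) in (suc (proj₁ p) , proj₂ p)
... | no  _ = (0 , suc n)

-- ν(x): largest k with 7^k ∣ x  (meaningful for x ≠ 0)
ν : ℤ → ℕ
ν x = proj₁ (strip ∣ x ∣ ∣ x ∣)

-- r(x): residue mod 7 (in {0,…,6}) of x / 7^ν(x)
r : ℤ → ℕ
r x = (sign x ◃ proj₂ (strip ∣ x ∣ ∣ x ∣)) %ℕ 7

res : ℤ → ℕ
res x = x %ℕ 7

GoodSet : (Fin 5 → ℤ) → Set
GoodSet A = Injective _≡_ _≡_ A
          × (∀ i → (res (A i) ≡ 1) Data.Sum.⊎ ((res (A i) ≡ 2) Data.Sum.⊎ (res (A i) ≡ 4)))
  where import Data.Sum

SameResidueSubset : (Fin 5 → ℤ) → (k : ℕ) → (Fin k → Fin 5) → Set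
SameResidueSubset A k f = Injective _≡_ _≡_ f × (∀ i j → res (A (f i)) ≡ res (A (f j)))

IsLargestClass : (Fin 5 → ℤ) → (k : ℕ) → (Fin k → Fin 5) → Set
IsLargestClass A k f = SameResidueSubset A k f
  × (∀ m (g : Fin m → Fin 5) → SameResidueSubset A m g → m ≤ k)

Lemma8Concl : ℕ → ℤ → ℤ → ℤ → Set
Lemma8Concl s d₁ d₂ d₃ =
  (ν e₁₃ > ν e₂₃ × ν e₂₃ ≡ ν e₁₂)
  ⊎ (ν e₁₃ ≡ ν e₂₃
     × (r e₁₃ ≡ (2 * r e₂₃) % 7
        ⊎ (r e₁₃ ≡ (3 * r e₂₃) % 7 × (r e₁₃ ≡ s ⊎ r e₁₃ ≡ 7 ∸ s))))
  where
  open import Data.Sum using (_⊎_)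
  open import Data.Nat using (_>_; _∸_)
  e₁₃ = d₁ - d₃
  e₂₃ = d₂ - d₃
  e₁₂ = d₁ - d₂

module Submission where

-- Lemma 8 in fact holds for ANY three distinct integers d₀, d₁, d₂ (the residue hypotheses on A
-- only guarantee that A₁ consists of three distinct elements). Write d₀ - d₂ = 7^a·U and
-- d₁ - d₂ = 7^b·V with U, V units modulo 7 (a "factorisation"); then ν = a, b and r = res U, res V.
--   * a ≠ b: by the strict ultrametric property, ν(d₀ - d₁) = min(a, b), giving case (i) for the
--     labeling that puts the point with the larger valuation first.
--   * a = b and U ≡ V (mod 7): then ν(d₀ - d₁) > a = ν(d₂ - d₁), case (i) for (d₀, d₂, d₁).
--   * a = b and U ≢ V (mod 7): all three differences have valuation a and residues given by the
--     differences of p = res U, q = res V and 0; a finite table, verified by computation over all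
--     s, p, q modulo 7, provides a labeling satisfying the residue condition of case (ii).

open import Data.Nat as ℕ using (ℕ; zero; suc; _<_; _≤_; _%_; _/_; _∸_; _^_; z≤n; s≤s)
import Data.Nat.Properties as ℕ
import Data.Nat.DivMod as ℕ
open import Data.Integer as ℤ using (ℤ; -[1+_]; _+_; _-_; _*_; +_; 0ℤ; ∣_∣; sign; _◃_; _/ℕ_)
import Data.Integer.Properties as ℤ
open import Data.Integer.DivMod using (a≡a%ℕn+[a/ℕn]*n; n%ℕd<d)
open import Data.Integer.Tactic.RingSolver using (solve-∀)
open import Data.Product using (Σ; _×_; _,_; proj₁; proj₂)
open import Data.Sum using (_⊎_; inj₁; inj₂)
open import Data.Empty using (⊥-elim)
import Data.Sign as Sign
open import Relation.Binary.PropositionalEquality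
open import Relation.Binary.Definitions using (tri<; tri≈; tri>)
open import Function.Definitions using (Injective)
open import Relation.Nullary using (¬_; yes; no; Dec)
open import Relation.Nullary.Decidable using (_×-dec_; _⊎-dec_; _→-dec_; ¬?; toWitness)
open import Data.Fin as Fin using (Fin; toℕ; fromℕ<)
import Data.Fin.Properties as Fin
open import Defs

remainders-congruent : ∀ {a b} k → a < 7 → b < 7 → + a - + b ≡ k * + 7 → a ≡ b
remainders-congruent {a} {b} k a<7 b<7 eq = ℤ.+-injective (ℤ.i-j≡0⇒i≡j (+ a) (+ b) a-b≡0)
  where
  ∣a-b∣<7 : ∣ + a - + b ∣ < 7
  ∣a-b∣<7 = ℕ.≤-<-trans (subst (ℕ._≤ a ℕ.⊔ b) (cong ∣_∣ (sym (ℤ.m-n≡m⊖n a b))) (ℤ.∣m⊝n∣≤m⊔n a b))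
                        (ℕ.⊔-lub a<7 b<7)
  ∣k∣≡0 : ∣ k ∣ ≡ 0
  ∣k∣≡0 = ℕ.n<1⇒n≡0 (ℕ.*-cancelʳ-< 7 ∣ k ∣ 1
            (subst (_< 7) (trans (cong ∣_∣ eq) (ℤ.abs-* k (+ 7))) ∣a-b∣<7))
  a-b≡0 : + a - + b ≡ 0ℤ
  a-b≡0 = trans eq (cong (_* + 7) (ℤ.∣i∣≡0⇒i≡0 {k} ∣k∣≡0))

res-unique : ∀ {x} a q → a < 7 → x ≡ + a + q * + 7 → res x ≡ a
res-unique {x} a q a<7 eq = remainders-congruent (q - x /ℕ 7) (n%ℕd<d x 7) a<7 (begin
    + res x - + a                                              ≡⟨ shift (+ res x) (+ a) (x /ℕ 7) q ⟩
    (+ res x + x /ℕ 7 * + 7) - (+ a + q * + 7) + (q - x /ℕ 7) * + 7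
      ≡⟨ cong₂ (λ y z → y - z + (q - x /ℕ 7) * + 7) (sym (a≡a%ℕn+[a/ℕn]*n x 7)) (sym eq) ⟩
    x - x + (q - x /ℕ 7) * + 7                                 ≡⟨ cancel x ((q - x /ℕ 7) * + 7) ⟩
    (q - x /ℕ 7) * + 7                                         ∎)
  where
  open ≡-Reasoning
  shift : ∀ r a Q q → r - a ≡ (r + Q * + 7) - (a + q * + 7) + (q - Q) * + 7
  shift = solve-∀
  cancel : ∀ x y → x - x + y ≡ y
  cancel = solve-∀

res-periodic : ∀ x c → res (x + c * + 7) ≡ res x
res-periodic x c = res-unique (res x) (x /ℕ 7 + c) (n%ℕd<d x 7) (begin
    x + c * + 7                        ≡⟨ cong (_+ c * + 7) (a≡a%ℕn+[a/ℕn]*n x 7) ⟩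
    + res x + x /ℕ 7 * + 7 + c * + 7   ≡⟨ regroup (+ res x) (x /ℕ 7) c ⟩
    + res x + (x /ℕ 7 + c) * + 7       ∎)
  where
  open ≡-Reasoning
  regroup : ∀ r Q c → r + Q * + 7 + c * + 7 ≡ r + (Q + c) * + 7
  regroup = solve-∀

sub7 : ℕ → ℕ → ℕ
sub7 a b = (a ℕ.+ (7 ∸ b)) % 7

res-difference : ∀ x y → res (x - y) ≡ sub7 (res x) (res y)
res-difference x y = begin
    res (x - y)
      ≡⟨ cong res (cong₂ _-_ (a≡a%ℕn+[a/ℕn]*n x 7) (a≡a%ℕn+[a/ℕn]*n y 7)) ⟩
    res ((+ res x + x /ℕ 7 * + 7) - (+ res y + y /ℕ 7 * + 7))
      ≡⟨ cong res (borrow (+ res x) (+ res y) (x /ℕ 7) (y /ℕ 7)) ⟩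
    res (+ res x + (+ 7 - + res y) + c * + 7)
      ≡⟨ res-periodic (+ res x + (+ 7 - + res y)) c ⟩
    res (+ res x + (+ 7 - + res y))
      ≡⟨ cong (λ z → res (+ res x + z)) 7-res ⟩
    res (+ (res x ℕ.+ (7 ∸ res y)))
      ∎
  where
  open ≡-Reasoning
  c = x /ℕ 7 - y /ℕ 7 - + 1
  borrow : ∀ a b Q R → (a + Q * + 7) - (b + R * + 7) ≡ a + (+ 7 - b) + (Q - R - + 1) * + 7
  borrow = solve-∀
  7-res : + 7 - + res y ≡ + (7 ∸ res y)
  7-res = trans (ℤ.m-n≡m⊖n 7 (res y)) (ℤ.⊖-≥ (ℕ.<⇒≤ (n%ℕd<d y 7)))

factorisation-positive : ∀ k m → m % 7 ≢ 0 → 0 < 7 ^ k ℕ.* m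
factorisation-positive k zero m≢0 = ⊥-elim (m≢0 refl)
factorisation-positive k (suc m) _ =
  ℕ.>-nonZero⁻¹ (7 ^ k ℕ.* suc m) {{ℕ.m*n≢0 (7 ^ k) (suc m) {{ℕ.m^n≢0 7 k}}}}

peel : ∀ k m → 7 ^ suc k ℕ.* m ≡ 7 ^ k ℕ.* m ℕ.* 7
peel k m = trans (ℕ.*-assoc 7 (7 ^ k) m) (ℕ.*-comm 7 (7 ^ k ℕ.* m))

quotient-fuel : ∀ {n f} → n ≤ f → suc n / 7 ≤ f
quotient-fuel {n} n≤f = ℕ.<⇒≤pred (ℕ.<-≤-trans (ℕ.m/n<m (suc n) 7 (s≤s (s≤s z≤n))) (s≤s n≤f))

quotient-positive : ∀ {n} → suc n % 7 ≡ 0 → 0 < suc n / 7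
quotient-positive {n} 7∣n =
  ℕ.m≥n⇒m/n>0 {suc n} {7} (ℕ.≮⇒≥ (λ n<7 → ℕ.0≢1+n (trans (sym 7∣n) (ℕ.m<n⇒m%n≡m n<7))))

strip-unique : ∀ f n k m → n ≡ 7 ^ k ℕ.* m → m % 7 ≢ 0 → n ≤ f → strip f n ≡ (k , m)
strip-unique f zero k m eq m≢0 _ = ⊥-elim (ℕ.<-irrefl eq (factorisation-positive k m m≢0))
strip-unique zero (suc n) k m eq m≢0 ()
strip-unique (suc f) (suc n) k m eq m≢0 (s≤s n≤f) with suc n % 7 ℕ.≟ 0 | k
... | yes 7∣n | zero  = ⊥-elim (m≢0 (trans (cong (_% 7) (trans (sym (ℕ.+-identityʳ m)) (sym eq))) 7∣n))
... | no  _   | zero  = cong (0 ,_) (trans eq (ℕ.+-identityʳ m))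
... | no  7∤n | suc k = ⊥-elim (7∤n (trans (cong (_% 7) (trans eq (peel k m))) (ℕ.m*n%n≡0 (7 ^ k ℕ.* m) 7)))
... | yes _   | suc k =
  cong (λ p → suc (proj₁ p) , proj₂ p) (strip-unique f (suc n / 7) k m n/7≡ m≢0 (quotient-fuel n≤f))
  where
  n/7≡ : suc n / 7 ≡ 7 ^ k ℕ.* m
  n/7≡ = trans (ℕ./-congˡ (trans eq (peel k m))) (ℕ.m*n/n≡m (7 ^ k ℕ.* m) 7)

strip-sound : ∀ f n → n ≤ f → 0 < n →
  n ≡ 7 ^ proj₁ (strip f n) ℕ.* proj₂ (strip f n) × proj₂ (strip f n) % 7 ≢ 0
strip-sound zero (suc n) () _
strip-sound (suc f) (suc n) (s≤s n≤f) _ with suc n % 7 ℕ.≟ 0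
... | no 7∤n = sym (ℕ.+-identityʳ (suc n)) , 7∤n
... | yes 7∣n with strip-sound f (suc n / 7) (quotient-fuel n≤f) (quotient-positive {n} 7∣n)
... | n/7≡ , m≢0 = (begin
    suc n                          ≡⟨ ℕ.m≡m%n+[m/n]*n (suc n) 7 ⟩
    suc n % 7 ℕ.+ suc n / 7 ℕ.* 7  ≡⟨ cong (λ t → t ℕ.+ suc n / 7 ℕ.* 7) 7∣n ⟩
    suc n / 7 ℕ.* 7                ≡⟨ cong (ℕ._* 7) n/7≡ ⟩
    7 ^ k ℕ.* m ℕ.* 7              ≡⟨ sym (peel k m) ⟩
    7 ^ suc k ℕ.* m                ∎) , m≢0
  where
  open ≡-Reasoning
  k = proj₁ (strip f (suc n / 7))
  m = proj₂ (strip f (suc n / 7))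

Unit : ℤ → Set
Unit u = res u ≢ 0

res-multiple : ∀ c → res (c * + 7) ≡ 0
res-multiple c = trans (cong res (sym (ℤ.+-identityˡ (c * + 7)))) (res-periodic 0ℤ c)

unit-difference : ∀ x y → res x ≢ res y → Unit (x - y)
unit-difference x y res-x≢res-y res[x-y]≡0 = res-x≢res-y (begin
    res x                                          ≡⟨ cong res (split x y) ⟩
    res (y + (x - y))                              ≡⟨ cong (λ z → res (y + z)) (a≡a%ℕn+[a/ℕn]*n (x - y) 7) ⟩
    res (y + (+ res (x - y) + (x - y) /ℕ 7 * + 7)) ≡⟨ cong (λ n → res (y + (+ n + (x - y) /ℕ 7 * + 7))) res[x-y]≡0 ⟩
    res (y + (0ℤ + (x - y) /ℕ 7 * + 7))            ≡⟨ cong (λ z → res (y + z)) (ℤ.+-identityˡ _) ⟩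
    res (y + (x - y) /ℕ 7 * + 7)                   ≡⟨ res-periodic y ((x - y) /ℕ 7) ⟩
    res y                                          ∎)
  where
  open ≡-Reasoning
  split : ∀ x y → x ≡ y + (x - y)
  split = solve-∀

sub7-self : ∀ {a} → a ≤ 7 → sub7 a a ≡ 0
sub7-self a≤7 = cong (_% 7) (ℕ.m+[n∸m]≡n a≤7)

non-unit-difference : ∀ x y → res x ≡ res y → ¬ Unit (x - y)
non-unit-difference x y res-x≡res-y unit =
  unit (trans (res-difference x y) (trans (cong (λ a → sub7 a (res y)) res-x≡res-y) (sub7-self (ℕ.<⇒≤ (n%ℕd<d y 7)))))

unit⇒abs : ∀ u → Unit u → ∣ u ∣ % 7 ≢ 0
unit⇒abs (+ n) unit = unit
unit⇒abs -[1+ n ] unit with suc n % 7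
... | zero  = λ _ → unit refl
... | suc _ = λ ()

abs⇒unit : ∀ u → ∣ u ∣ % 7 ≢ 0 → Unit u
abs⇒unit (+ n) 7∤n = 7∤n
abs⇒unit -[1+ n ] 7∤n with suc n % 7 | ℕ.m%n<n (suc n) 7
... | zero  | _   = ⊥-elim (7∤n refl)
... | suc r | r<7 = ℕ.m>n⇒m∸n≢0 r<7

pow7 : ℕ → ℤ
pow7 k = + (7 ^ k)

record Factorisation (x : ℤ) (k : ℕ) (u : ℤ) : Set where
  constructor factorisation
  field
    factorises : x ≡ pow7 k * u
    unit       : Unit u

open Factorisation using (factorises; unit)

factorise : ∀ x → x ≢ 0ℤ → Σ ℕ λ k → Σ ℤ λ u → Factorisation x k u
factorise x x≢0 = k , sign x ◃ m ,
  factorisation x≡ (abs⇒unit (sign x ◃ m) (subst (λ n → n % 7 ≢ 0) (sym (ℤ.abs-◃ (sign x) m)) 7∤m))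
  where
  open ≡-Reasoning
  k = proj₁ (strip ∣ x ∣ ∣ x ∣)
  m = proj₂ (strip ∣ x ∣ ∣ x ∣)
  sound : ∣ x ∣ ≡ 7 ^ k ℕ.* m × m % 7 ≢ 0
  sound = strip-sound (∣ x ∣) (∣ x ∣) ℕ.≤-refl (ℕ.n≢0⇒n>0 (λ ∣x∣≡0 → x≢0 (ℤ.∣i∣≡0⇒i≡0 ∣x∣≡0)))
  7∤m = proj₂ sound
  x≡ : x ≡ pow7 k * (sign x ◃ m)
  x≡ = begin
    x                            ≡⟨ sym (ℤ.◃-inverse x) ⟩
    sign x ◃ ∣ x ∣               ≡⟨ cong (sign x ◃_) (proj₁ sound) ⟩
    sign x ◃ (7 ^ k ℕ.* m)       ≡⟨ ℤ.◃-distrib-* Sign.+ (sign x) (7 ^ k) m ⟩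
    (Sign.+ ◃ 7 ^ k) * (sign x ◃ m) ≡⟨ cong (_* (sign x ◃ m)) (ℤ.+◃n≡+n (7 ^ k)) ⟩
    pow7 k * (sign x ◃ m)        ∎

valuation-residue : ∀ {x k u} → Factorisation x k u → ν x ≡ k × r x ≡ res u
valuation-residue {x} {k} {u} (factorisation x≡ unit-u) =
  cong proj₁ stripped , trans (cong (λ p → res (sign x ◃ proj₂ p)) stripped) (cong res sign-x◃∣u∣≡u)
  where
  7∤∣u∣ = unit⇒abs u unit-u
  ∣x∣≡ : ∣ x ∣ ≡ 7 ^ k ℕ.* ∣ u ∣
  ∣x∣≡ = trans (cong ∣_∣ x≡) (ℤ.abs-* (pow7 k) u)
  stripped : strip ∣ x ∣ ∣ x ∣ ≡ (k , ∣ u ∣)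
  stripped = strip-unique (∣ x ∣) (∣ x ∣) k (∣ u ∣) ∣x∣≡ 7∤∣u∣ ℕ.≤-refl
  instance
    7^k∣u∣≢0 : ℕ.NonZero (7 ^ k ℕ.* ∣ u ∣)
    7^k∣u∣≢0 = ℕ.m*n≢0 (7 ^ k) (∣ u ∣)
      {{ℕ.m^n≢0 7 k}} {{ℕ.≢-nonZero (λ ∣u∣≡0 → 7∤∣u∣ (cong (_% 7) ∣u∣≡0))}}
  sign-x◃∣u∣≡u : sign x ◃ ∣ u ∣ ≡ u
  sign-x◃∣u∣≡u =
    trans (cong (_◃ ∣ u ∣) (trans (cong sign x≡) (ℤ.sign-◃ (sign u) (7 ^ k ℕ.* ∣ u ∣)))) (ℤ.◃-inverse u)

difference-via : ∀ x y z → x - y ≡ (x - z) - (y - z)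
difference-via = solve-∀

pow7-+ : ∀ m n → pow7 (m ℕ.+ n) ≡ pow7 m * pow7 n
pow7-+ m n = trans (cong +_ (ℕ.^-distribˡ-+-* 7 m n)) (ℤ.pos-* (7 ^ m) (7 ^ n))

rescale : ∀ {X c w} a → Factorisation X c w → Factorisation (pow7 a * X) (a ℕ.+ c) w
rescale {X} {c} {w} a (factorisation X≡ unit-w) = factorisation
  (trans (cong (pow7 a *_) X≡) (trans (sym (ℤ.*-assoc (pow7 a) (pow7 c) w)) (cong (_* w) (sym (pow7-+ a c))))) unit-w

offset-difference : ∀ x y c a {u v} → x - c ≡ pow7 a * u → y - c ≡ pow7 a * v → x - y ≡ pow7 a * (u - v)
offset-difference x y c a {u} {v} x-c≡ y-c≡ = begin
    x - y                       ≡⟨ difference-via x y c ⟩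
    (x - c) - (y - c)           ≡⟨ cong₂ _-_ x-c≡ y-c≡ ⟩
    pow7 a * u - pow7 a * v     ≡⟨ factor-out (pow7 a) u v ⟩
    pow7 a * (u - v)            ∎
  where
  open ≡-Reasoning
  factor-out : ∀ P u v → P * u - P * v ≡ P * (u - v)
  factor-out = solve-∀

base-offset : ∀ c a → c - c ≡ pow7 a * 0ℤ
base-offset c a = trans (ℤ.+-inverseʳ c) (sym (ℤ.*-zeroʳ (pow7 a)))

ultrametric : ∀ {X Y a b u v} → b < a → Factorisation X a u → Factorisation Y b v →
  Σ ℤ λ w → Factorisation (X - Y) b w
ultrametric {X} {Y} {a} {b} {u} {v} b<a (factorisation X≡ _) (factorisation Y≡ unit-v) with ℕ.m≤n⇒∃[o]m+o≡n b<a
... | o , refl = pow7 o * u * + 7 - v , factorisation X-Y≡ unit-w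
  where
  open ≡-Reasoning
  regroup : ∀ P Q u v → + 7 * (P * Q) * u - P * v ≡ P * (Q * u * + 7 - v)
  regroup = solve-∀
  X-Y≡ : X - Y ≡ pow7 b * (pow7 o * u * + 7 - v)
  X-Y≡ = begin
    X - Y                                      ≡⟨ cong₂ _-_ X≡ Y≡ ⟩
    pow7 (1 ℕ.+ (b ℕ.+ o)) * u - pow7 b * v
      ≡⟨ cong (λ P → P * u - pow7 b * v) (trans (pow7-+ 1 (b ℕ.+ o)) (cong (+ 7 *_) (pow7-+ b o))) ⟩
    + 7 * (pow7 b * pow7 o) * u - pow7 b * v   ≡⟨ regroup (pow7 b) (pow7 o) u v ⟩
    pow7 b * (pow7 o * u * + 7 - v)            ∎
  unit-w : Unit (pow7 o * u * + 7 - v)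
  unit-w = unit-difference (pow7 o * u * + 7) v (λ res≡ → unit-v (trans (sym res≡) (res-multiple (pow7 o * u))))

congruent-difference : ∀ x y → x - y ≢ 0ℤ → res x ≡ res y →
  Σ ℕ λ c → Σ ℤ λ w → Factorisation (x - y) (suc c) w
congruent-difference x y x-y≢0 res≡ with factorise (x - y) x-y≢0
... | suc c , w , f = c , w , f
... | zero  , w , factorisation x-y≡ unit-w =
  ⊥-elim (non-unit-difference x y res≡ (subst Unit (sym (trans x-y≡ (ℤ.*-identityˡ w))) unit-w))

case-i : ∀ s d₁ d₂ d₃ {a b u v} → b < a → Factorisation (d₁ - d₃) a u → Factorisation (d₂ - d₃) b v →
  Lemma8Concl s d₁ d₂ d₃
case-i s d₁ d₂ d₃ b<a f₁₃ f₂₃ with ultrametric b<a f₁₃ f₂₃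
... | w , factorisation e≡ unit-w = inj₁ (subst₂ _<_ (sym ν₂₃) (sym ν₁₃) b<a , trans ν₂₃ (sym ν₁₂))
  where
  ν₁₃ = proj₁ (valuation-residue f₁₃)
  ν₂₃ = proj₁ (valuation-residue f₂₃)
  ν₁₂ = proj₁ (valuation-residue (factorisation (trans (difference-via d₁ d₂ d₃) e≡) unit-w))

ResidueCondition : ℕ → ℕ → ℕ → Set
ResidueCondition s R S = (R ≡ (2 ℕ.* S) % 7) ⊎ ((R ≡ (3 ℕ.* S) % 7) × (R ≡ s ⊎ R ≡ 7 ∸ s))

case-ii : ∀ s d₁ d₂ d₃ {h u v} → Factorisation (d₁ - d₃) h u → Factorisation (d₂ - d₃) h v →
  ResidueCondition s (res u) (res v) → Lemma8Concl s d₁ d₂ d₃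
case-ii s d₁ d₂ d₃ f₁₃ f₂₃ cond with valuation-residue f₁₃ | valuation-residue f₂₃
... | ν₁₃ , r₁₃ | ν₂₃ , r₂₃ =
  inj₂ (trans ν₁₃ (sym ν₂₃) , subst₂ (ResidueCondition s) (sym r₁₃) (sym r₂₃) cond)

Distinct : Fin 3 → Fin 3 → Fin 3 → Set
Distinct i₁ i₂ i₃ = i₁ ≢ i₂ × i₁ ≢ i₃ × i₂ ≢ i₃

pattern 0F = Fin.zero
pattern 1F = Fin.suc Fin.zero
pattern 2F = Fin.suc (Fin.suc Fin.zero)

-- Residues modulo 7 of three points relative to the third one: p, q and 0.
positions : ℕ → ℕ → Fin 3 → ℕ
positions p q 0F = p
positions p q 1F = q
positions p q 2F = 0

GoodResidueLabeling : ℕ → (Fin 3 → ℕ) → Set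
GoodResidueLabeling s x = Σ (Fin 3) λ i₁ → Σ (Fin 3) λ i₂ → Σ (Fin 3) λ i₃ →
  Distinct i₁ i₂ i₃ × ResidueCondition s (sub7 (x i₁) (x i₃)) (sub7 (x i₂) (x i₃))

good-residue-labeling? : ∀ s x → Dec (GoodResidueLabeling s x)
good-residue-labeling? s x = Fin.any? λ i₁ → Fin.any? λ i₂ → Fin.any? λ i₃ →
  distinct? i₁ i₂ i₃ ×-dec condition? (sub7 (x i₁) (x i₃)) (sub7 (x i₂) (x i₃))
  where
  distinct? : ∀ i₁ i₂ i₃ → Dec (Distinct i₁ i₂ i₃)
  distinct? i₁ i₂ i₃ = ¬? (i₁ Fin.≟ i₂) ×-dec ¬? (i₁ Fin.≟ i₃) ×-dec ¬? (i₂ Fin.≟ i₃)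
  condition? : ∀ R S → Dec (ResidueCondition s R S)
  condition? R S = (R ℕ.≟ (2 ℕ.* S) % 7) ⊎-dec ((R ℕ.≟ (3 ℕ.* S) % 7) ×-dec ((R ℕ.≟ s) ⊎-dec (R ℕ.≟ 7 ∸ s)))

TableEntry : ℕ → ℕ → ℕ → Set
TableEntry s p q = s ≢ 0 → p ≢ 0 → q ≢ 0 → p ≢ q → GoodResidueLabeling s (positions p q)

table : ∀ (s p q : Fin 7) → TableEntry (toℕ s) (toℕ p) (toℕ q)
table = toWitness {a? = Fin.all? λ s → Fin.all? λ p → Fin.all? λ q → entry? (toℕ s) (toℕ p) (toℕ q)} _
  where
  entry? : ∀ s p q → Dec (TableEntry s p q)
  entry? s p q = ¬? (s ℕ.≟ 0) →-dec (¬? (p ℕ.≟ 0) →-dec (¬? (q ℕ.≟ 0) →-dec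
    (¬? (p ℕ.≟ q) →-dec good-residue-labeling? s (positions p q))))

-- A ternary property holding at every point of Fin n holds for all numbers below n.
-- (P is kept abstract, so the table is not re-evaluated when transported.)
lift-below : ∀ {n} (P : ℕ → ℕ → ℕ → Set) → (∀ (s p q : Fin n) → P (toℕ s) (toℕ p) (toℕ q)) →
  ∀ {s p q} → s < n → p < n → q < n → P s p q
lift-below P h s<n p<n q<n
  with fromℕ< s<n | Fin.toℕ-fromℕ< s<n | fromℕ< p<n | Fin.toℕ-fromℕ< p<n | fromℕ< q<n | Fin.toℕ-fromℕ< q<n
... | s | refl | p | refl | q | refl = h s p q

residue-table : ∀ {s p q} → s < 7 → p < 7 → q < 7 → TableEntry s p q
residue-table = lift-below TableEntry table

positions-separated : ∀ {p q} → p ≢ 0 → q ≢ 0 → p ≢ q → ∀ {i j} → i ≢ j → positions p q i ≢ positions p q j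
positions-separated p≢0 q≢0 p≢q {0F} {0F} i≢j = ⊥-elim (i≢j refl)
positions-separated p≢0 q≢0 p≢q {0F} {1F} _ = p≢q
positions-separated p≢0 q≢0 p≢q {0F} {2F} _ = p≢0
positions-separated p≢0 q≢0 p≢q {1F} {0F} _ = λ q≡p → p≢q (sym q≡p)
positions-separated p≢0 q≢0 p≢q {1F} {1F} i≢j = ⊥-elim (i≢j refl)
positions-separated p≢0 q≢0 p≢q {1F} {2F} _ = q≢0
positions-separated p≢0 q≢0 p≢q {2F} {0F} _ = λ 0≡p → p≢0 (sym 0≡p)
positions-separated p≢0 q≢0 p≢q {2F} {1F} _ = λ 0≡q → q≢0 (sym 0≡q)
positions-separated p≢0 q≢0 p≢q {2F} {2F} i≢j = ⊥-elim (i≢j refl)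

GoodLabeling : ℕ → (Fin 3 → ℤ) → Set
GoodLabeling s d = Σ (Fin 3) λ i₁ → Σ (Fin 3) λ i₂ → Σ (Fin 3) λ i₃ →
  Distinct i₁ i₂ i₃ × Lemma8Concl s (d i₁) (d i₂) (d i₃)

-- Equal valuations, incongruent cofactors: d 0 and d 1 sit at offsets 7^a·U and 7^a·V from d 2 with
-- res U ≢ res V. Then all differences have valuation a, and the residue table yields case (ii).
incongruent-case : ∀ s → 1 ≤ s → s < 7 → (d : Fin 3 → ℤ) → ∀ {a U V} →
  Factorisation (d 0F - d 2F) a U → Factorisation (d 1F - d 2F) a V → res U ≢ res V → GoodLabeling s d
incongruent-case s 1≤s s<7 d {a} {U} {V} f₀ f₁ p≢q =
  lift (residue-table s<7 (n%ℕd<d U 7) (n%ℕd<d V 7) (ℕ.m<n⇒n≢0 1≤s) (unit f₀) (unit f₁) p≢q)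
  where
  offsets : Fin 3 → ℤ
  offsets 0F = U
  offsets 1F = V
  offsets 2F = 0ℤ
  offset : ∀ i → d i - d 2F ≡ pow7 a * offsets i
  offset 0F = factorises f₀
  offset 1F = factorises f₁
  offset 2F = base-offset (d 2F) a
  res-offsets : ∀ i → res (offsets i) ≡ positions (res U) (res V) i
  res-offsets 0F = refl
  res-offsets 1F = refl
  res-offsets 2F = refl
  residue : ∀ i j → res (offsets i - offsets j) ≡ sub7 (positions (res U) (res V) i) (positions (res U) (res V) j)
  residue i j = trans (res-difference (offsets i) (offsets j)) (cong₂ sub7 (res-offsets i) (res-offsets j))
  difference : ∀ {i j} → i ≢ j → Factorisation (d i - d j) a (offsets i - offsets j)
  difference {i} {j} i≢j = factorisation (offset-difference (d i) (d j) (d 2F) a (offset i) (offset j))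
    (unit-difference (offsets i) (offsets j)
      (λ e → positions-separated (unit f₀) (unit f₁) p≢q i≢j (trans (sym (res-offsets i)) (trans e (res-offsets j)))))
  lift : GoodResidueLabeling s (positions (res U) (res V)) → GoodLabeling s d
  lift (i₁ , i₂ , i₃ , distinct@(_ , i₁≢i₃ , i₂≢i₃) , cond) =
    i₁ , i₂ , i₃ , distinct , case-ii s (d i₁) (d i₂) (d i₃) (difference i₁≢i₃) (difference i₂≢i₃)
      (subst₂ (ResidueCondition s) (sym (residue i₁ i₃)) (sym (residue i₂ i₃)) cond)

injective-difference : ∀ {d : Fin 3 → ℤ} → Injective _≡_ _≡_ d → ∀ {i j} → i ≢ j → d i - d j ≢ 0ℤ
injective-difference {d} d-injective {i} {j} i≢j dᵢ-dⱼ≡0 = i≢j (d-injective (ℤ.i-j≡0⇒i≡j (d i) (d j) dᵢ-dⱼ≡0))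

-- Equal valuations, congruent cofactors: d 0 - d 1 = 7^a·(U - V) has valuation > a = ν(d 2 - d 1),
-- so case (i) applies to the labeling (d 0, d 2, d 1).
congruent-case : ∀ s (d : Fin 3 → ℤ) → Injective _≡_ _≡_ d → ∀ {a U V} →
  Factorisation (d 0F - d 2F) a U → Factorisation (d 1F - d 2F) a V → res U ≡ res V → GoodLabeling s d
congruent-case s d d-injective {a} {U} {V} f₀ f₁ p≡q = label (congruent-difference U V U-V≢0 p≡q)
  where
  d₀-d₁≡ : d 0F - d 1F ≡ pow7 a * (U - V)
  d₀-d₁≡ = offset-difference (d 0F) (d 1F) (d 2F) a (factorises f₀) (factorises f₁)
  U-V≢0 : U - V ≢ 0ℤ
  U-V≢0 U-V≡0 = injective-difference d-injective {0F} {1F} (λ ())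
    (trans d₀-d₁≡ (trans (cong (pow7 a *_) U-V≡0) (ℤ.*-zeroʳ (pow7 a))))
  f₂₁ : Factorisation (d 2F - d 1F) a (0ℤ - V)
  f₂₁ = factorisation (offset-difference (d 2F) (d 1F) (d 2F) a (base-offset (d 2F) a) (factorises f₁))
                      (unit-difference 0ℤ V (λ 0≡res-V → unit f₁ (sym 0≡res-V)))
  label : (Σ ℕ λ c → Σ ℤ λ W → Factorisation (U - V) (suc c) W) → GoodLabeling s d
  label (c , W , f-U-V) = 0F , 2F , 1F , ((λ ()) , (λ ()) , (λ ())) ,
    case-i s (d 0F) (d 2F) (d 1F) (ℕ.m<m+n a ℕ.z<s) f₀₁ f₂₁
    where
    f₀₁ : Factorisation (d 0F - d 1F) (a ℕ.+ suc c) W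
    f₀₁ = factorisation (trans d₀-d₁≡ (factorises (rescale a f-U-V))) (unit f-U-V)

three-point-lemma : ∀ s → 1 ≤ s → s < 7 → (d : Fin 3 → ℤ) → Injective _≡_ _≡_ d → GoodLabeling s d
three-point-lemma s 1≤s s<7 d d-injective
  with factorise (d 0F - d 2F) (injective-difference d-injective {0F} {2F} (λ ()))
     | factorise (d 1F - d 2F) (injective-difference d-injective {1F} {2F} (λ ()))
... | a , U , f₀ | b , V , f₁ with ℕ.<-cmp a b
... | tri< a<b _ _ = 1F , 0F , 2F , ((λ ()) , (λ ()) , (λ ())) , case-i s (d 1F) (d 0F) (d 2F) a<b f₁ f₀
... | tri> _ _ b<a = 0F , 1F , 2F , ((λ ()) , (λ ()) , (λ ())) , case-i s (d 0F) (d 1F) (d 2F) b<a f₀ f₁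
... | tri≈ _ refl _ with res U ℕ.≟ res V
...   | yes p≡q = congruent-case s d d-injective f₀ f₁ p≡q
...   | no  p≢q = incongruent-case s 1≤s s<7 d f₀ f₁ p≢q

lemma8 : (A : Fin 5 → ℤ) → GoodSet A
    → (a : Fin 3 → Fin 5) → IsLargestClass A 3 a
    → (s : ℕ) → 1 ≤ s → s < 7
    → Σ (Fin 3) λ i₁ → Σ (Fin 3) λ i₂ → Σ (Fin 3) λ i₃ →
        (i₁ ≢ i₂ × i₁ ≢ i₃ × i₂ ≢ i₃) × Lemma8Concl s (A (a i₁)) (A (a i₂)) (A (a i₃))
lemma8 A (A-injective , _) a ((a-injective , _) , _) s 1≤s s<7 =
  three-point-lemma s 1≤s s<7 (λ i → A (a i)) (λ A-aᵢ≡A-aⱼ → a-injective (A-injective A-aᵢ≡A-aⱼ))
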